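{- Let $e\in\{2,3,4\}$ and let $j_e\in\mathbb{Z}^+$ be the smallest integer such that $j_e!>j_e^{e-1}$. If $n\in\mathbb{Z}^+$ with $n>M_e$, where $M_e=\sum_{i=1}^{j_e} i\cdot i!$, then $n-S_{e,!}(n)>0$.
   Context: Every positive integer $n$ has a unique factoradic (factorial base) representation $n=\sum_{i=1}^k a_i\cdot i!$ with $a_k\neq 0$ and $0\leq a_i\leq i$ for $1\leq i\leq k$. For an integer $e\geq 1$, the $e$-power factoradic happy function $S_{e,!}:\mathbb{Z}_{\geq 0}\to\mathbb{Z}_{\geq 0}$ is defined by $S_{e,!}(0)=0$ and $S_{e,!}(n)=\sum_{i=1}^k a_i^e$ for $n\geq 1$. -}

module Defs where

open import Data.Nat using (ℕ; zero; suc; _+_; _*_; _^_; _<_; _≤_; _!)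
open import Data.Nat.DivMod using (_/_; _%_)
open import Data.List using (List; []; _∷_; map; upTo)
open import Data.Nat.ListAction using (sum)

-- Factoradic digits: digitsFrom b fuel n lists the digits of n w.r.t. the
-- mixed radix b, b+1, b+2, ...; fuel bounds the recursion (fuel = n suffices,
-- since each step at least halves n).
digitsFrom : (b : ℕ) → ℕ → ℕ → List ℕ
digitsFrom b zero    n = []
digitsFrom b (suc f) zero = []
digitsFrom b (suc f) (suc m) =
  ((suc m) % (suc (suc b))) ∷ digitsFrom (suc b) f ((suc m) / (suc (suc b)))

-- factoradic n = [a_1, a_2, ..., a_k] with n = Σ a_i * i!, 0 ≤ a_i ≤ i, a_k ≠ 0
-- (empty list for n = 0). a_1 is n mod 2, a_2 = (n div 2) mod 3, etc.
factoradic : ℕ → List ℕ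
factoradic n = digitsFrom 0 n n

S! : ℕ → ℕ → ℕ
S! e n = sum (map (λ a → a ^ e) (factoradic n))

M : ℕ → ℕ
M j = sum (map (λ i → suc i * (suc i) !) (upTo j))

-- the defining property of j_e: j ≥ 1 and j! > j^(e-1)  (stated with e = suc d)
JProp : ℕ → ℕ → Set
JProp d j = (1 ≤ j) × (j ^ d < j !)
  where open import Data.Product using (_×_)

{-# OPTIONS --safe #-}
-- Write n = Σ a_i · i! with n ≥ (j + 1)!, e = 1 + d and G = 1 + Σ_{i<j} i ^ e. For i ≥ j,
-- a_i ^ e = a_i · a_i ^ d ≤ a_i · i ^ d ≤ a_i · i!; a nonzero digit above position j exists, and
-- since i ^ d + G ≤ i! there, it contributes at least G less than its value. The digits below
-- position j contribute at most i ^ e each, which G - 1 absorbs, so S(n) + G ≤ n + G - 1.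
module Submission where

open import Defs
open import Data.Nat using (ℕ; suc; _<_; _≤_; _∸_)
open import Data.Sum using (_⊎_)
open import Relation.Binary.PropositionalEquality using (_≡_)

open import Data.Nat using (zero; _+_; _*_; _^_; _!; z≤n; s≤s; z<s; _≤′_; ≤′-refl; ≤′-step; _≤?_; _<?_; NonZero)
open import Data.Nat.Properties
open import Data.Nat.DivMod using (_/_; _%_; m≡m%n+[m/n]*n; m%n<n; m≥n⇒m/n>0; m*n/n≡m; /-monoˡ-≤)
open import Data.List using (map)
open import Data.Nat.ListAction using (sum)
open import Data.Sum using (inj₁; inj₂)
open import Data.Product using (proj₂)
open import Function using (_∘_)
open import Relation.Nullary using (¬_; ¬?)
open import Relation.Nullary.Decidable using (from-yes; _×-dec_)
open import Relation.Unary using (Pred; Decidable)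
open import Relation.Binary.PropositionalEquality using (refl; sym; trans; cong; subst₂; module ≡-Reasoning)
open import Algebra.Properties.CommutativeSemigroup +-commutativeSemigroup
  using (xy∙z≈xz∙y; x∙yz≈y∙xz)
open import Algebra.Properties.CommutativeSemigroup *-commutativeSemigroup
  using () renaming (interchange to *-interchange)

m*n≤o⇒m≤o/n : ∀ m n {o} .{{_ : NonZero n}} → m * n ≤ o → m ≤ o / n
m*n≤o⇒m≤o/n m n m*n≤o = subst₂ _≤_ (m*n/n≡m m n) refl (/-monoˡ-≤ n m*n≤o)

[m*n]^o≡m^o*n^o : ∀ m n o → (m * n) ^ o ≡ m ^ o * n ^ o
[m*n]^o≡m^o*n^o m n zero    = refl
[m*n]^o≡m^o*n^o m n (suc o) = begin
  m * n * (m * n) ^ o         ≡⟨ cong (m * n *_) ([m*n]^o≡m^o*n^o m n o) ⟩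
  m * n * (m ^ o * n ^ o)     ≡⟨ *-interchange m n (m ^ o) (n ^ o) ⟩
  m * m ^ o * (n * n ^ o)     ∎
  where open ≡-Reasoning

[1+i]^d≤[1+i]*i^d : ∀ d {i} → 1 ≤ i → 2 ^ d ≤ suc i → suc i ^ d ≤ suc i * i ^ d
[1+i]^d≤[1+i]*i^d d {i} 1≤i 2^d≤1+i = begin
  suc i ^ d        ≤⟨ ^-monoˡ-≤ d (+-mono-≤ 1≤i (m≤m+n i 0)) ⟩
  (2 * i) ^ d      ≡⟨ [m*n]^o≡m^o*n^o 2 i d ⟩
  2 ^ d * i ^ d    ≤⟨ *-monoˡ-≤ (i ^ d) 2^d≤1+i ⟩
  suc i * i ^ d    ∎
  where open ≤-Reasoning

i^d+c≤i! : ∀ d c {i₀} → 1 ≤ i₀ → 2 ^ d ≤ suc i₀ → i₀ ^ d + c ≤ i₀ ! →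
           ∀ {i} → i₀ ≤ i → i ^ d + c ≤ i !
i^d+c≤i! d c {i₀} 1≤i₀ 2^d≤1+i₀ base i₀≤i = go (≤⇒≤′ i₀≤i)
  where
  go : ∀ {i} → i₀ ≤′ i → i ^ d + c ≤ i !
  go ≤′-refl = base
  go {suc i} (≤′-step i₀≤′i) = begin
    suc i ^ d + c               ≤⟨ +-mono-≤ ([1+i]^d≤[1+i]*i^d d (≤-trans 1≤i₀ (≤′⇒≤ i₀≤′i))
                                                                  (≤-trans 2^d≤1+i₀ (s≤s (≤′⇒≤ i₀≤′i))))
                                            (m≤n*m c (suc i)) ⟩
    suc i * i ^ d + suc i * c   ≡⟨ *-distribˡ-+ (suc i) (i ^ d) c ⟨
    suc i * (i ^ d + c)         ≤⟨ *-monoʳ-≤ (suc i) (go i₀≤′i) ⟩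
    suc i * i !                 ∎
    where open ≤-Reasoning

digit≤ : ∀ b m → m % suc (suc b) ≤ suc b
digit≤ b m = ≤-pred (m%n<n m (suc (suc b)))

value-split : ∀ b m → m * suc b ! ≡ m % suc (suc b) * suc b ! + m / suc (suc b) * suc (suc b) !
value-split b m = begin
  m * F                       ≡⟨ cong (_* F) (m≡m%n+[m/n]*n m (suc (suc b))) ⟩
  (r + q * suc (suc b)) * F   ≡⟨ *-distribʳ-+ F r (q * suc (suc b)) ⟩
  r * F + q * suc (suc b) * F ≡⟨ cong (r * F +_) (*-assoc q (suc (suc b)) F) ⟩
  r * F + q * suc (suc b) !   ∎
  where open ≡-Reasoning
        F r q : ℕ
        F = suc b !
        r = m % suc (suc b)
        q = m / suc (suc b)

factorialRatio : ℕ → ℕ → ℕ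
factorialRatio zero    b = suc (suc b)
factorialRatio (suc k) b = factorialRatio k (suc b) * suc (suc b)

factorialRatio*! : ∀ k b → factorialRatio k b * suc b ! ≡ suc (suc b + k) !
factorialRatio*! zero    b = cong (λ x → suc (suc x) !) (sym (+-identityʳ b))
factorialRatio*! (suc k) b = begin
  factorialRatio k (suc b) * suc (suc b) * suc b !   ≡⟨ *-assoc (factorialRatio k (suc b)) (suc (suc b)) (suc b !) ⟩
  factorialRatio k (suc b) * suc (suc b) !           ≡⟨ factorialRatio*! k (suc b) ⟩
  suc (suc (suc b) + k) !                            ≡⟨ cong (λ x → suc (suc x) !) (+-suc b k) ⟨
  suc (suc b + suc k) !                              ∎
  where open ≡-Reasoning

sumPowers : ℕ → ℕ → ℕ → ℕ
sumPowers e zero    b = 0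
sumPowers e (suc k) b = suc b ^ e + sumPowers e k (suc b)

module DigitPowerBounds (d j G : ℕ) (j^d≤j! : j ^ d ≤ j !)
                        (room : ∀ {i} → j < i → i ^ d + G ≤ i !) where

  -- Given enough fuel f, digitsFrom b f m are the factoradic digits of m * (1 + b)! at positions
  -- 1 + b, 2 + b, …; the bounds below hold for any fuel.
  powerSum : ℕ → ℕ → ℕ → ℕ
  powerSum b f m = sum (map (λ a → a ^ suc d) (digitsFrom b f m))

  i^d≤i! : ∀ {i} → j ≤ i → i ^ d ≤ i !
  i^d≤i! j≤i with m≤n⇒m<n∨m≡n j≤i
  ... | inj₁ j<i  = ≤-trans (m≤m+n _ G) (room j<i)
  ... | inj₂ refl = j^d≤j!

  a^[1+d]≤a*i! : ∀ {a i} → j ≤ i → a ≤ i → a ^ suc d ≤ a * i !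
  a^[1+d]≤a*i! {a} j≤i a≤i = *-monoʳ-≤ a (≤-trans (^-monoˡ-≤ d a≤i) (i^d≤i! j≤i))

  a^[1+d]+G≤a*i! : ∀ {a i} → j < i → suc a ≤ i → suc a ^ suc d + G ≤ suc a * i !
  a^[1+d]+G≤a*i! {a} {i} j<i a≤i = begin
    suc a * suc a ^ d + G                ≤⟨ +-monoʳ-≤ (suc a * suc a ^ d) (m≤n*m G (suc a)) ⟩
    suc a * suc a ^ d + suc a * G        ≡⟨ *-distribˡ-+ (suc a) (suc a ^ d) G ⟨
    suc a * (suc a ^ d + G)              ≤⟨ *-monoʳ-≤ (suc a) (+-monoˡ-≤ G (^-monoˡ-≤ d a≤i)) ⟩
    suc a * (i ^ d + G)                  ≤⟨ *-monoʳ-≤ (suc a) (room j<i) ⟩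
    suc a * i !                          ∎
    where open ≤-Reasoning

  powerSum≤value : ∀ f b m → j ≤ suc b → powerSum b f m ≤ m * suc b !
  powerSum≤value zero    b m       _   = z≤n
  powerSum≤value (suc f) b zero    _   = z≤n
  powerSum≤value (suc f) b (suc m) j≤1+b = begin
    a ^ suc d + powerSum (suc b) f q     ≤⟨ +-mono-≤ (a^[1+d]≤a*i! j≤1+b (digit≤ b (suc m)))
                                                     (powerSum≤value f (suc b) q (m≤n⇒m≤1+n j≤1+b)) ⟩
    a * suc b ! + q * suc (suc b) !      ≡⟨ value-split b (suc m) ⟨
    suc m * suc b !                      ∎
    where open ≤-Reasoning
          a q : ℕ
          a = suc m % suc (suc b)
          q = suc m / suc (suc b)

  powerSum+G≤value : ∀ f b m → j < suc b → 0 < m → powerSum b f m + G ≤ m * suc b !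
  digit+powerSum+G≤value : ∀ f b {m} a q → j < suc b → a ≤ suc b → suc m ≡ a + q * suc (suc b) →
                           a ^ suc d + powerSum (suc b) f q + G ≤ a * suc b ! + q * suc (suc b) !

  powerSum+G≤value zero    b (suc m) j<1+b _ = ≤-trans (≤-trans (m≤n+m G _) (room j<1+b)) (m≤m+n _ _)
  powerSum+G≤value (suc f) b (suc m) j<1+b _ = ≤-trans
    (digit+powerSum+G≤value f b (suc m % suc (suc b)) (suc m / suc (suc b)) j<1+b
       (digit≤ b (suc m)) (m≡m%n+[m/n]*n (suc m) (suc (suc b))))
    (≤-reflexive (sym (value-split b (suc m))))

  digit+powerSum+G≤value f b zero    zero    j<1+b _   ()
  digit+powerSum+G≤value f b zero    (suc q) j<1+b _   _ =
    powerSum+G≤value f (suc b) (suc q) (m<n⇒m<1+n j<1+b) z<s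
  digit+powerSum+G≤value f b (suc a) q       j<1+b a≤b _ = begin
    suc a ^ suc d + T + G                ≡⟨ xy∙z≈xz∙y (suc a ^ suc d) T G ⟩
    suc a ^ suc d + G + T                ≤⟨ +-mono-≤ (a^[1+d]+G≤a*i! j<1+b a≤b)
                                                     (powerSum≤value f (suc b) q (<⇒≤ (m<n⇒m<1+n j<1+b))) ⟩
    suc a * suc b ! + q * suc (suc b) !  ∎
    where open ≤-Reasoning
          T : ℕ
          T = powerSum (suc b) f q

  G≤value : ∀ {k b m} → suc b + k ≡ j → factorialRatio k b ≤ m → G ≤ m * suc b !
  G≤value {k} {b} {m} 1+b+k≡j r≤m = begin
    G                             ≤⟨ ≤-trans (m≤n+m G _) (room (n<1+n j)) ⟩
    suc j !                       ≡⟨ cong (λ x → suc x !) 1+b+k≡j ⟨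
    suc (suc b + k) !             ≡⟨ factorialRatio*! k b ⟨
    factorialRatio k b * suc b !  ≤⟨ *-monoˡ-≤ (suc b !) r≤m ⟩
    m * suc b !                   ∎
    where open ≤-Reasoning

  -- factorialRatio k b ≤ m says m * (1 + b)! ≥ (1 + j)!, so some digit above position j is
  -- nonzero; the low positions 1 + b, …, j - 1 may exceed a * i!, by at most i ^ (1 + d) each.
  powerSum+G≤value+slack : ∀ k b → suc b + k ≡ j → ∀ f m → factorialRatio k b ≤ m →
                           powerSum b f m + G ≤ m * suc b ! + sumPowers (suc d) k b
  powerSum+G≤value+slack k b eq zero m r≤m = ≤-trans (G≤value {k} {b} eq r≤m) (m≤m+n _ _)
  powerSum+G≤value+slack k b eq (suc f) zero r≤m = ≤-trans (G≤value {k} {b} eq r≤m) (m≤m+n _ _)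
  powerSum+G≤value+slack zero b eq (suc f) (suc m) r≤m = begin
    a ^ suc d + T + G                    ≡⟨ +-assoc (a ^ suc d) T G ⟩
    a ^ suc d + (T + G)                  ≤⟨ +-mono-≤ (a^[1+d]≤a*i! (≤-reflexive j≡1+b) (digit≤ b (suc m)))
                                                     (powerSum+G≤value f (suc b) q (s≤s (≤-reflexive j≡1+b)) (m≥n⇒m/n>0 r≤m)) ⟩
    a * suc b ! + q * suc (suc b) !      ≡⟨ value-split b (suc m) ⟨
    suc m * suc b !                      ≡⟨ +-identityʳ _ ⟨
    suc m * suc b ! + 0                  ∎
    where open ≤-Reasoning
          a q T : ℕ
          a = suc m % suc (suc b)
          q = suc m / suc (suc b)
          T = powerSum (suc b) f q
          j≡1+b : j ≡ suc b
          j≡1+b = trans (sym eq) (+-identityʳ (suc b))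
  powerSum+G≤value+slack (suc k) b eq (suc f) (suc m) r≤m = begin
    a ^ suc d + T + G                    ≡⟨ +-assoc (a ^ suc d) T G ⟩
    a ^ suc d + (T + G)                  ≤⟨ +-mono-≤ (^-monoˡ-≤ (suc d) (digit≤ b (suc m)))
                                                     (powerSum+G≤value+slack k (suc b) (trans (sym (+-suc (suc b) k)) eq) f q
                                                        (m*n≤o⇒m≤o/n _ (suc (suc b)) r≤m)) ⟩
    suc b ^ suc d + (q * F′ + s)         ≡⟨ x∙yz≈y∙xz (suc b ^ suc d) (q * F′) s ⟩
    q * F′ + (suc b ^ suc d + s)         ≤⟨ m≤n+m _ (a * suc b !) ⟩
    a * suc b ! + (q * F′ + (suc b ^ suc d + s))  ≡⟨ +-assoc (a * suc b !) (q * F′) _ ⟨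
    a * suc b ! + q * F′ + (suc b ^ suc d + s)    ≡⟨ cong (_+ (suc b ^ suc d + s)) (value-split b (suc m)) ⟨
    suc m * suc b ! + (suc b ^ suc d + s)         ∎
    where open ≤-Reasoning
          a q T F′ s : ℕ
          a = suc m % suc (suc b)
          q = suc m / suc (suc b)
          T = powerSum (suc b) f q
          F′ = suc (suc b) !
          s = sumPowers (suc d) k (suc b)

S!<n : ∀ d k → suc k ^ d ≤ suc k ! → 2 ^ d ≤ 3 + k →
       (2 + k) ^ d + suc (sumPowers (suc d) k 0) ≤ (2 + k) ! →
       ∀ n → (2 + k) ! ≤ n → S! (suc d) n < n
S!<n d k k^d≤k! 2^d≤3+k base n bound = +-cancelʳ-≤ s (suc (S! (suc d) n)) n (begin
  suc (S! (suc d) n) + s   ≡⟨ +-suc (S! (suc d) n) s ⟨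
  S! (suc d) n + suc s     ≤⟨ powerSum+G≤value+slack k 0 refl n n ratio≤n ⟩
  n * 1 + s                ≡⟨ cong (_+ s) (*-identityʳ n) ⟩
  n + s                    ∎)
  where
  open ≤-Reasoning
  s : ℕ
  s = sumPowers (suc d) k 0
  open DigitPowerBounds d (suc k) (suc s) k^d≤k! (i^d+c≤i! d (suc s) (s≤s z≤n) 2^d≤3+k base)
  ratio≤n : factorialRatio k 0 ≤ n
  ratio≤n = ≤-trans (≤-reflexive (trans (sym (*-identityʳ _)) (factorialRatio*! k 0))) bound

least-unique : ∀ {p} {P : Pred ℕ p} {i j} → P i → (∀ {k} → k < i → ¬ P k) →
               P j → (∀ k → P k → j ≤ k) → j ≡ i
least-unique Pi below Pj least = ≤-antisym (least _ Pi) (≮⇒≥ λ j<i → below j<i Pj)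

JProp? : ∀ d → Decidable (JProp d)
JProp? d j = (1 ≤? j) ×-dec (j ^ d <? j !)

theorem2p6 : (e : ℕ) → (e ≡ 2 ⊎ e ≡ 3 ⊎ e ≡ 4) →
    (j : ℕ) → JProp (e ∸ 1) j → ((k : ℕ) → JProp (e ∸ 1) k → j ≤ k) →
    (n : ℕ) → 1 ≤ n → M j < n → S! e n < n
-- Once j is a numeral, M j < n computes to (1 + j)! ≤ n.
theorem2p6 .2 (inj₁ refl) j j-ok j-least n _ M<n
  with refl ← least-unique (from-yes (JProp? 1 3)) (from-yes (allUpTo? (¬? ∘ JProp? 1) 3)) j-ok j-least
  = S!<n 1 2 (<⇒≤ (proj₂ j-ok)) (≤ᵇ⇒≤ _ _ _) (≤ᵇ⇒≤ _ _ _) n M<n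
theorem2p6 .3 (inj₂ (inj₁ refl)) j j-ok j-least n _ M<n
  with refl ← least-unique (from-yes (JProp? 2 4)) (from-yes (allUpTo? (¬? ∘ JProp? 2) 4)) j-ok j-least
  = S!<n 2 3 (<⇒≤ (proj₂ j-ok)) (≤ᵇ⇒≤ _ _ _) (≤ᵇ⇒≤ _ _ _) n M<n
theorem2p6 .4 (inj₂ (inj₂ refl)) j j-ok j-least n _ M<n
  with refl ← least-unique (from-yes (JProp? 3 6)) (from-yes (allUpTo? (¬? ∘ JProp? 3) 6)) j-ok j-least
  = S!<n 3 5 (<⇒≤ (proj₂ j-ok)) (≤ᵇ⇒≤ _ _ _) (≤ᵇ⇒≤ _ _ _) n M<n
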